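{- Let $q\in\mathbb{N}$, $r\in\{0,\dots,q-1\}$ and $\varepsilon,\xi\in[0,1]$. Let $G$ be an $(\varepsilon,\xi,q,r)$-supercomplex, let $i\in\{0,\dots,r\}$ and let $F\subseteq G^{(i)}$ with $1\le|F|\le 2^i$. Then $\bigcap_{f\in F}G(f)$ is an $(\varepsilon,\xi,q-i,r-i)$-supercomplex.
   Context: A complex is a hypergraph $G$ closed under taking subsets; $G$ is empty if $\emptyset\notin G$; $G^{(i)}$ is the $i$-graph on $V(G)$ of edges of size $i$. For $e\subseteq V(G)$, $G(e)$ is the complex on $V(G)\setminus e$ of all $f$ with $e\cup f\in G$; for $e\in G^{(r)}$, $G^{(q)}(e)$ is the set of $(q-r)$-sets $f$ with $e\cup f\in G$. The intersection of complexes is the complex on the intersection of their vertex sets consisting of the common edges. For a $q$-graph $Y$ on $V(G)$, $G[Y]$ is the complex of all $e\in G$ all of whose $q$-subsets lie in $Y$. $a=b\pm c$ means $b-c\le a\le b+c$. For a complex $G$ on $n$ vertices, $q\in\mathbb{N}$, $r\in\{0,\dots,q-1\}$: $(\varepsilon,d,q,r)$-regular: $|G^{(q)}(e)|=(d\pm\varepsilon)n^{q-r}$ for all $e\in G^{(r)}$; $(\xi,q,r)$-dense: $|G^{(q)}(e)|\ge\xi n^{q-r}$ for all $e\in G^{(r)}$; $(\xi,q,r)$-extendable: $G^{(r)}$ empty or some $X\subseteq V(G)$ with $|X|\ge\xi n$ is such that every $r$-subset $e$ of $X$ has at least $\xi n^{q-r}$ $(q-r)$-sets $Q\subseteq V(G)\setminus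 e$ with $\binom{Q\cup e}{r}\setminus\{e\}\subseteq G^{(r)}$. Full $(\varepsilon,\xi,q,r)$-complex: $(\varepsilon,d,q,r)$-regular for some $d\ge\xi$, $(\xi,q+r,r)$-dense, $(\xi,q,r)$-extendable. $(\varepsilon,\xi,q,r)$-complex: $G[Y]$ is a full $(\varepsilon,\xi,q,r)$-complex for some $q$-graph $Y$ on $V(G)$. $(\varepsilon,\xi,q,r)$-supercomplex: for all $i\in\{0,\dots,r\}$ and $F\subseteq G^{(i)}$ with $1\le|F|\le2^i$, $\bigcap_{f\in F}G(f)$ is an $(\varepsilon,\xi,q-i,r-i)$-complex. -}

module Defs where

open import Data.Bool using (Bool; true; false; _∧_; _∨_; not; T)
open import Data.Nat using (ℕ; zero; suc; _∸_; _^_; _≡ᵇ_)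
import Data.Nat as Nat
open import Data.List using (List; []; _∷_; map; _++_; length; filterᵇ; foldr)
open import Data.List.Relation.Unary.All using (All)
open import Data.List.Relation.Unary.Unique.Propositional using (Unique)
open import Data.Vec using ([]; _∷_)
open import Data.Fin.Subset using (Subset; _⊆_; _∩_; _∪_; _─_; ∣_∣; ⊤; inside; outside)
open import Data.Product using (Σ; _×_)
open import Data.Sum using (_⊎_)
open import Relation.Binary.PropositionalEquality using (_≡_; _≢_)

-- The
-- standard library has no reals, so we quantify over an arbitrary
-- carrier with order, ring operations and an embedding of ℕ; the reals
-- are one instance.

record Scalars : Set₁ where
  field
    Carrier : Set
    _≤_     : Carrier → Carrier → Set
    _+_     : Carrier → Carrier → Carrier
    _-_     : Carrier → Carrier → Carrier
    _*_     : Carrier → Carrier → Carrier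
    0#      : Carrier
    1#      : Carrier
    fromℕ   : ℕ → Carrier
  infix  4 _≤_
  infixl 6 _+_ _-_
  infixl 7 _*_

allSubsets : (N : ℕ) → List (Subset N)
allSubsets zero    = [] ∷ []
allSubsets (suc N) = map (outside ∷_) (allSubsets N) ++ map (inside ∷_) (allSubsets N)

module _ {N : ℕ} where

  _⊆ᵇ_ : Subset N → Subset N → Bool
  a ⊆ᵇ b = ∣ a ─ b ∣ ≡ᵇ 0

  _==ˢ_ : Subset N → Subset N → Bool
  a ==ˢ b = (a ⊆ᵇ b) ∧ (b ⊆ᵇ a)

  countˢ : (Subset N → Bool) → ℕ
  countˢ P = length (filterᵇ P (allSubsets N))

  allˢ : (Subset N → Bool) → Bool
  allˢ P = foldr (λ s b → P s ∧ b) true (allSubsets N)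

record Hypergraph (N : ℕ) : Set where
  constructor hg
  field
    V : Subset N
    E : Subset N → Bool
open Hypergraph public

module _ {N : ℕ} where

  IsComplex : Hypergraph N → Set
  IsComplex G = (∀ e → T (E G e) → e ⊆ V G)
              × (∀ e f → f ⊆ e → T (E G e) → T (E G f))

  InLayer : Hypergraph N → ℕ → Subset N → Set
  InLayer G i e = T (E G e) × ∣ e ∣ ≡ i

  link : Hypergraph N → Subset N → Hypergraph N
  link G e = hg (V G ─ e) (λ f → (f ⊆ᵇ (V G ─ e)) ∧ E G (e ∪ f))

  -- intersection of complexes: on the intersection of the vertex sets,
  -- with the common edges (only used for nonempty lists)
  ⋂ : List (Hypergraph N) → Hypergraph N
  ⋂ []       = hg ⊤ (λ _ → true)
  ⋂ (G ∷ Gs) = hg (V G ∩ V (⋂ Gs))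
                  (λ e → E G e ∧ E (⋂ Gs) e ∧ (e ⊆ᵇ (V G ∩ V (⋂ Gs))))

  IsGraphOn : ℕ → Subset N → (Subset N → Bool) → Set
  IsGraphOn q W Y = ∀ y → T (Y y) → (y ⊆ W) × ∣ y ∣ ≡ q

  restrict : ℕ → Hypergraph N → (Subset N → Bool) → Hypergraph N
  restrict q G Y = hg (V G) (λ e → E G e ∧
                     allˢ (λ y → not ((y ⊆ᵇ e) ∧ (∣ y ∣ ≡ᵇ q)) ∨ Y y))

  -- |G^{(q)}(e)| for e ∈ G^{(r)}: number of (q-r)-sets f ⊆ V(G)\e
  -- with e ∪ f ∈ G
  linkCount : Hypergraph N → ℕ → ℕ → Subset N → ℕ
  linkCount G q r e = countˢ (λ f → (f ⊆ᵇ (V G ─ e)) ∧ (∣ f ∣ ≡ᵇ (q ∸ r)) ∧ E G (e ∪ f))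

  extCount : Hypergraph N → ℕ → ℕ → Subset N → ℕ
  extCount G q r e = countˢ (λ Q → (Q ⊆ᵇ (V G ─ e)) ∧ (∣ Q ∣ ≡ᵇ (q ∸ r)) ∧
    allˢ (λ s → not ((s ⊆ᵇ (Q ∪ e)) ∧ (∣ s ∣ ≡ᵇ r) ∧ not (s ==ˢ e)) ∨ E G s))

module _ (S : Scalars) {N : ℕ} where
  open Scalars S

  nV : Hypergraph N → ℕ
  nV G = ∣ V G ∣

  Regular : Carrier → Carrier → ℕ → ℕ → Hypergraph N → Set
  Regular ε d q r G = ∀ e → InLayer G r e →
      ((d - ε) * fromℕ (nV G ^ (q ∸ r)) ≤ fromℕ (linkCount G q r e))
    × (fromℕ (linkCount G q r e) ≤ (d + ε) * fromℕ (nV G ^ (q ∸ r)))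

  Dense : Carrier → ℕ → ℕ → Hypergraph N → Set
  Dense ξ q r G = ∀ e → InLayer G r e →
    ξ * fromℕ (nV G ^ (q ∸ r)) ≤ fromℕ (linkCount G q r e)

  Extendable : Carrier → ℕ → ℕ → Hypergraph N → Set
  Extendable ξ q r G =
      (∀ e → T (E G e) → ∣ e ∣ ≢ r)
    ⊎ Σ (Subset N) (λ X → (X ⊆ V G) × (ξ * fromℕ (nV G) ≤ fromℕ ∣ X ∣)
        × (∀ e → e ⊆ X → ∣ e ∣ ≡ r →
             ξ * fromℕ (nV G ^ (q ∸ r)) ≤ fromℕ (extCount G q r e)))

  FullComplex : Carrier → Carrier → ℕ → ℕ → Hypergraph N → Set
  FullComplex ε ξ q r G =
    Σ Carrier (λ d → (ξ ≤ d) × Regular ε d q r G)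
    × Dense ξ (q Nat.+ r) r G × Extendable ξ q r G

  QRComplex : Carrier → Carrier → ℕ → ℕ → Hypergraph N → Set
  QRComplex ε ξ q r G = Σ (Subset N → Bool) (λ Y →
    IsGraphOn q (V G) Y × FullComplex ε ξ q r (restrict q G Y))

  Supercomplex : Carrier → Carrier → ℕ → ℕ → Hypergraph N → Set
  Supercomplex ε ξ q r G = ∀ i → i Nat.≤ r → (F : List (Subset N)) → Unique F →
    All (InLayer G i) F → 1 Nat.≤ length F → length F Nat.≤ 2 ^ i →
    QRComplex ε ξ (q ∸ i) (r ∸ i) (⋂ (map (link G) F))

-- Links compose: if f′ is an edge of H = ⋂_{f ∈ F} G(f), then f′ is disjoint from every f ∈ F and
-- H(f′) = ⋂_{f ∈ F} G(f ∪ f′). Hence, for a family F′ of i′-edges of H, the complex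
-- ⋂_{f′ ∈ F′} H(f′) is the intersection of the links of G over F ⊗ F′ = {f ∪ f′}, a family of at
-- most 2^i · 2^i′ distinct (i + i′)-edges of G, to which the supercomplex property of G applies.
-- That H is a complex holds because links and intersections of complexes are complexes.

module Submission where

open import Defs
open import Data.Bool using (Bool; T; T?; _∧_; _∨_; not)
open import Data.Bool.Properties using (T-∧; T-≡; ⇔→≡)
open import Data.Fin.Subset using (Subset; _∈_; _∉_; _⊆_; _∪_; _─_; ∣_∣; ⊥; inside; outside)
open import Data.Fin.Subset.Properties
  using (x∈p∩q⁺; x∈p∩q⁻; x∈p∪q⁺; x∈p∪q⁻; ⊆-antisym; ⊆-trans; ∪-assoc; p─q⊆p; p─q─r≡p─q∪r;
         x∈p∧x∉q⇒x∈p─q; ∈⊤; Empty-unique; ∣⊥∣≡0; _∈?_)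
open import Data.List using (List; []; _∷_; _++_; map; length; cartesianProductWith)
open import Data.List.Properties using (length-++; length-map; filter-≐; foldr-cong)
open import Data.List.Membership.Propositional using () renaming (_∈_ to _∈ₗ_)
open import Data.List.Membership.Propositional.Properties
  using (∈-map⁻; ∈-cartesianProductWith⁺; ∈-cartesianProductWith⁻)
open import Data.List.Relation.Binary.Disjoint.Propositional
  using () renaming (Disjoint to Disjointₗ)
open import Data.List.Relation.Unary.All as All using (All; []; _∷_)
import Data.List.Relation.Unary.All.Properties as All
open import Data.List.Relation.Unary.Any using (here; there)
open import Data.List.Relation.Unary.Unique.Propositional using (Unique; []; _∷_)
import Data.List.Relation.Unary.Unique.Propositional.Properties as Unique
open import Data.Nat using (ℕ; suc; _+_; _*_; _^_; _∸_; _≤_; _<_; _≡ᵇ_)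
open import Data.Nat.Properties
  using (≡ᵇ⇒≡; ≡⇒≡ᵇ; +-suc; *-mono-≤; ^-distribˡ-+-*; ∸-+-assoc; m+[n∸m]≡n; +-monoʳ-≤;
         ≤-trans; ≤-reflexive)
open import Data.Product using (_×_; _,_; proj₁; proj₂; uncurry)
open import Data.Product.Function.NonDependent.Propositional using (_×-⇔_)
open import Data.Sum as Sum using (inj₁; inj₂; [_,_])
open import Data.Unit using (tt)
open import Data.Vec using ([]; _∷_; here; there)
open import Function using (id; _∘_)
open import Function.Bundles using (_⇔_; mk⇔; Equivalence)
import Function.Properties.Equivalence as ⇔
open import Level using (0ℓ)
open import Relation.Nullary using (yes; no; contradiction)
open import Relation.Binary.PropositionalEquality as ≡
  using (_≡_; _≗_; refl; sym; trans; cong; cong₂; subst; subst₂)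

open Equivalence using (to; from)

private variable n : ℕ

Unique-map⁺ : ∀ {A B : Set} (f : A → B) {xs} →
  (∀ {x y} → x ∈ₗ xs → y ∈ₗ xs → f x ≡ f y → x ≡ y) →
  Unique xs → Unique (map f xs)
Unique-map⁺ f         inj []            = []
Unique-map⁺ f {x ∷ _} inj (x∉xs ∷ xs!) =
  All.map⁺ (All.tabulate λ y∈ fx≡fy → All.lookup x∉xs y∈ (inj (here refl) (there y∈) fx≡fy))
  ∷ Unique-map⁺ f (λ x∈ y∈ → inj (there x∈) (there y∈)) xs!

module _ {A B C : Set} where

  length-cartesianProductWith : ∀ (g : A → B → C) xs ys →
    length (cartesianProductWith g xs ys) ≡ length xs * length ys
  length-cartesianProductWith g []       ys = refl
  length-cartesianProductWith g (x ∷ xs) ys = begin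
    length (map (g x) ys ++ cartesianProductWith g xs ys)
      ≡⟨ length-++ (map (g x) ys) ⟩
    length (map (g x) ys) + length (cartesianProductWith g xs ys)
      ≡⟨ cong₂ _+_ (length-map (g x) ys) (length-cartesianProductWith g xs ys) ⟩
    length ys + length xs * length ys ∎
    where open ≡.≡-Reasoning

  All-cartesianProductWith⇔ : ∀ {P : C → Set} (g : A → B → C) xs ys →
    All P (cartesianProductWith g xs ys) ⇔ All (λ y → All (λ x → P (g x y)) xs) ys
  All-cartesianProductWith⇔ g xs ys = mk⇔
    (λ all → All.tabulate λ y∈ → All.tabulate λ x∈ →
      All.lookup all (∈-cartesianProductWith⁺ g x∈ y∈))
    (λ all → All.cartesianProductWith⁺ (≡.setoid A) (≡.setoid B) g xs ys λ x∈ y∈ →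
      All.lookup (All.lookup all y∈) x∈)

  -- Unlike the library's version, g only needs to be injective on xs × ys.
  Unique-cartesianProductWith⁺ : ∀ (g : A → B → C) {xs ys} →
    (∀ {w x y z} → w ∈ₗ xs → x ∈ₗ xs → y ∈ₗ ys → z ∈ₗ ys → g w y ≡ g x z → w ≡ x × y ≡ z) →
    Unique xs → Unique ys → Unique (cartesianProductWith g xs ys)
  Unique-cartesianProductWith⁺ g inj [] ys! = []
  Unique-cartesianProductWith⁺ g {x ∷ xs} {ys} inj (x∉xs ∷ xs!) ys! =
    Unique.++⁺ (Unique-map⁺ (g x) (λ y∈ z∈ eq → proj₂ (inj (here refl) (here refl) y∈ z∈ eq)) ys!)
               (Unique-cartesianProductWith⁺ g (λ w∈ x∈ → inj (there w∈) (there x∈)) xs! ys!)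
               disjoint
    where
    disjoint : Disjointₗ (map (g x) ys) (cartesianProductWith g xs ys)
    disjoint (v∈map , v∈prod) with ∈-map⁻ (g x) v∈map | ∈-cartesianProductWith⁻ g xs ys v∈prod
    ... | y , y∈ , v≡gxy | w , z , w∈ , z∈ , v≡gwz =
      All.lookup x∉xs w∈ (proj₁ (inj (here refl) (there w∈) y∈ z∈ (trans (sym v≡gxy) v≡gwz)))

module _ {A : Set} where

  All-×-constʳ : ∀ {P : A → Set} {Q : Set} {xs} → 1 ≤ length xs →
    All (λ x → P x × Q) xs ⇔ (All P xs × Q)
  All-×-constʳ {xs = _ ∷ _} _ = mk⇔
    (λ all → All.map proj₁ all , proj₂ (All.head all))
    (λ (all , q) → All.map (_, q) all)

  All-cong-on : ∀ {R P Q : A → Set} {xs} → All R xs → (∀ {x} → R x → P x ⇔ Q x) →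
    All P xs ⇔ All Q xs
  All-cong-on rs P⇔Q = mk⇔
    (λ ps → All.zipWith (λ (r , p) → to (P⇔Q r) p) (rs , ps))
    (λ qs → All.zipWith (λ (r , q) → from (P⇔Q r) q) (rs , qs))

  All-cong : ∀ {P Q : A → Set} {xs} → (∀ {x} → P x ⇔ Q x) → All P xs ⇔ All Q xs
  All-cong P⇔Q = mk⇔ (All.map (to P⇔Q)) (All.map (from P⇔Q))

Disjoint : Subset n → Subset n → Set
Disjoint p q = ∀ {x} → x ∈ p → x ∉ q

Disjoint-tail : ∀ {s t} {p q : Subset n} → Disjoint (s ∷ p) (t ∷ q) → Disjoint p q
Disjoint-tail p#q x∈p x∈q = p#q (there x∈p) (there x∈q)

x∈p─q⇒x∉q : ∀ (p q : Subset n) {x} → x ∈ p ─ q → x ∉ q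
x∈p─q⇒x∉q (inside  ∷ p) (inside  ∷ q) () here
x∈p─q⇒x∉q (outside ∷ p) (inside  ∷ q) () here
x∈p─q⇒x∉q (_       ∷ p) (_       ∷ q) (there x∈p─q) (there x∈q) = x∈p─q⇒x∉q p q x∈p─q x∈q

∈─⇔ : ∀ {p q : Subset n} {x} → x ∈ p ─ q ⇔ (x ∈ p × x ∉ q)
∈─⇔ {p = p} {q = q} = mk⇔ (λ x∈ → p─q⊆p p q x∈ , x∈p─q⇒x∉q p q x∈) (uncurry x∈p∧x∉q⇒x∈p─q)

∈─∪⇔ : ∀ {p q r : Subset n} {x} → x ∈ p ─ (q ∪ r) ⇔ (x ∈ p ─ q × x ∉ r)
∈─∪⇔ {p = p} {q} {r} {x} = subst (λ s → x ∈ s ⇔ (x ∈ p ─ q × x ∉ r)) (p─q─r≡p─q∪r p q r) ∈─⇔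

∣p∣≡0⇒x∉p : ∀ (p : Subset n) {x} → ∣ p ∣ ≡ 0 → x ∉ p
∣p∣≡0⇒x∉p (outside ∷ p) ∣p∣≡0 (there x∈p) = ∣p∣≡0⇒x∉p p ∣p∣≡0 x∈p

⊆ᵇ⇔⊆ : ∀ {p q : Subset n} → T (p ⊆ᵇ q) ⇔ p ⊆ q
⊆ᵇ⇔⊆ {n} {p} {q} = mk⇔ sound complete
  where
  sound : T (p ⊆ᵇ q) → p ⊆ q
  sound t {x} x∈p with x ∈? q
  ... | yes x∈q = x∈q
  ... | no  x∉q = contradiction (x∈p∧x∉q⇒x∈p─q x∈p x∉q) (∣p∣≡0⇒x∉p (p ─ q) (≡ᵇ⇒≡ _ 0 t))
  complete : p ⊆ q → T (p ⊆ᵇ q)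
  complete p⊆q = ≡⇒≡ᵇ _ 0 (trans (cong ∣_∣ p─q≡⊥) (∣⊥∣≡0 n))
    where
    p─q≡⊥ : p ─ q ≡ ⊥
    p─q≡⊥ = Empty-unique λ (x , x∈) → x∈p─q⇒x∉q p q x∈ (p⊆q (p─q⊆p p q x∈))

∣p∪q∣≡∣p∣+∣q∣ : ∀ (p q : Subset n) → Disjoint p q → ∣ p ∪ q ∣ ≡ ∣ p ∣ + ∣ q ∣
∣p∪q∣≡∣p∣+∣q∣ []            []            _    = refl
∣p∪q∣≡∣p∣+∣q∣ (inside  ∷ p) (inside  ∷ q) p#q = contradiction here (p#q here)
∣p∪q∣≡∣p∣+∣q∣ (inside  ∷ p) (outside ∷ q) p#q = cong suc (∣p∪q∣≡∣p∣+∣q∣ p q (Disjoint-tail p#q))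
∣p∪q∣≡∣p∣+∣q∣ (outside ∷ p) (inside  ∷ q) p#q =
  trans (cong suc (∣p∪q∣≡∣p∣+∣q∣ p q (Disjoint-tail p#q))) (sym (+-suc ∣ p ∣ ∣ q ∣))
∣p∪q∣≡∣p∣+∣q∣ (outside ∷ p) (outside ∷ q) p#q = ∣p∪q∣≡∣p∣+∣q∣ p q (Disjoint-tail p#q)

x∈p∪q∧x∉q⇒x∈p : ∀ {p q : Subset n} {x} → x ∈ p ∪ q → x ∉ q → x ∈ p
x∈p∪q∧x∉q⇒x∈p {p = p} {q} x∈p∪q x∉q with x∈p∪q⁻ p q x∈p∪q
... | inj₁ x∈p = x∈p
... | inj₂ x∈q = contradiction x∈q x∉q

x∈p∪q∧x∉p⇒x∈q : ∀ {p q : Subset n} {x} → x ∈ p ∪ q → x ∉ p → x ∈ q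
x∈p∪q∧x∉p⇒x∈q {p = p} {q} x∈p∪q x∉p with x∈p∪q⁻ p q x∈p∪q
... | inj₁ x∈p = contradiction x∈p x∉p
... | inj₂ x∈q = x∈q

∪-cancel : ∀ {p q r s : Subset n} → Disjoint p s → Disjoint r q → p ∪ q ≡ r ∪ s → p ≡ r × q ≡ s
∪-cancel {p = p} {q} {r} {s} p#s r#q p∪q≡r∪s = ⊆-antisym p⊆r r⊆p , ⊆-antisym q⊆s s⊆q
  where
  ⇒r∪s : ∀ {x} → x ∈ p ∪ q → x ∈ r ∪ s
  ⇒r∪s = subst (_ ∈_) p∪q≡r∪s
  ⇒p∪q : ∀ {x} → x ∈ r ∪ s → x ∈ p ∪ q
  ⇒p∪q = subst (_ ∈_) (sym p∪q≡r∪s)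
  p⊆r : p ⊆ r
  p⊆r x∈p = x∈p∪q∧x∉q⇒x∈p (⇒r∪s (x∈p∪q⁺ (inj₁ x∈p))) (p#s x∈p)
  r⊆p : r ⊆ p
  r⊆p x∈r = x∈p∪q∧x∉q⇒x∈p (⇒p∪q (x∈p∪q⁺ (inj₁ x∈r))) (r#q x∈r)
  q⊆s : q ⊆ s
  q⊆s x∈q = x∈p∪q∧x∉p⇒x∈q (⇒r∪s (x∈p∪q⁺ (inj₂ x∈q))) λ x∈r → r#q x∈r x∈q
  s⊆q : s ⊆ q
  s⊆q x∈s = x∈p∪q∧x∉p⇒x∈q (⇒p∪q (x∈p∪q⁺ (inj₂ x∈s))) λ x∈p → p#s x∈p x∈s

⊆-All⇔ : ∀ {A : Set} {S : A → Subset n} {as : List A} {e : Subset n} →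
  (∀ {x} → x ∈ e → All (λ a → x ∈ S a) as) ⇔ All (λ a → e ⊆ S a) as
⊆-All⇔ {S = S} {as} {e} = mk⇔ (λ e⊆ → All.tabulate λ a∈ {x} x∈e → All.lookup (e⊆ x∈e) a∈) pointwise
  where
  pointwise : All (λ a → e ⊆ S a) as → ∀ {x} → x ∈ e → All (λ a → x ∈ S a) as
  pointwise e⊆ x∈e = All.map (λ e⊆Sa → e⊆Sa x∈e) e⊆

∪-monoʳ-⊆ : ∀ (p : Subset n) {q r} → q ⊆ r → p ∪ q ⊆ p ∪ r
∪-monoʳ-⊆ p {q} q⊆r x∈ = x∈p∪q⁺ (Sum.map id q⊆r (x∈p∪q⁻ p q x∈))

∈-V-⋂ : ∀ (Gs : List (Hypergraph n)) {x} → x ∈ V (⋂ Gs) ⇔ All (λ A → x ∈ V A) Gs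
∈-V-⋂ []       = mk⇔ (λ _ → []) (λ _ → ∈⊤)
∈-V-⋂ (A ∷ Gs) = mk⇔
  (λ x∈ → proj₁ (x∈p∩q⁻ (V A) _ x∈) ∷ to (∈-V-⋂ Gs) (proj₂ (x∈p∩q⁻ (V A) _ x∈)))
  (λ { (x∈A ∷ x∈Gs) → x∈p∩q⁺ (x∈A , from (∈-V-⋂ Gs) x∈Gs) })

E-⋂ : ∀ (Gs : List (Hypergraph n)) e →
  T (E (⋂ Gs) e) ⇔ (All (λ A → T (E A e)) Gs × e ⊆ V (⋂ Gs))
E-⋂ []       e = mk⇔ (λ _ → [] , λ {x} _ → ∈⊤) (λ _ → tt)
E-⋂ (A ∷ Gs) e = mk⇔
  (λ t → let eA , rest = to T-∧ t ; eGs , e⊆ = to T-∧ rest in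
         (eA ∷ proj₁ (to (E-⋂ Gs e) eGs)) , λ {x} → to ⊆ᵇ⇔⊆ e⊆)
  (λ { (eA ∷ eGs , e⊆) → from T-∧ (eA , from T-∧
         (from (E-⋂ Gs e) (eGs , λ x∈ → proj₂ (x∈p∩q⁻ (V A) _ (e⊆ x∈))) , from ⊆ᵇ⇔⊆ e⊆)) })

E-link : ∀ (G : Hypergraph n) f e → T (E (link G f) e) ⇔ (e ⊆ V G ─ f × T (E G (f ∪ e)))
E-link G f e = ⇔.trans T-∧ (⊆ᵇ⇔⊆ ×-⇔ ⇔.refl)

∈-V-⋂link : ∀ (G : Hypergraph n) F {x} → x ∈ V (⋂ (map (link G) F)) ⇔ All (λ f → x ∈ V G ─ f) F
∈-V-⋂link G F = ⇔.trans (∈-V-⋂ (map (link G) F)) (mk⇔ All.map⁻ All.map⁺)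

E-⋂link : ∀ (G : Hypergraph n) F e →
  T (E (⋂ (map (link G) F)) e) ⇔ All (λ f → e ⊆ V G ─ f × T (E G (f ∪ e))) F
E-⋂link G F e = mk⇔
  (λ t → All.map (to (E-link G _ e)) (All.map⁻ (proj₁ (to (E-⋂ (map (link G) F) e) t))))
  (λ links → from (E-⋂ (map (link G) F) e)
     ( All.map⁺ (All.map (from (E-link G _ e)) links)
     , λ x∈e → from (∈-V-⋂link G F) (All.map (λ (e⊆ , _) → e⊆ x∈e) links)))

link-isComplex : ∀ {G : Hypergraph n} → IsComplex G → ∀ f → IsComplex (link G f)
link-isComplex {G = G} (_ , G-closed) f =
    (λ e t → proj₁ (to (E-link G f e) t))
  , (λ e e′ e′⊆e t → let e⊆ , fe∈G = to (E-link G f e) t in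
       from (E-link G f e′) (⊆-trans e′⊆e e⊆ , G-closed (f ∪ e) (f ∪ e′) (∪-monoʳ-⊆ f e′⊆e) fe∈G))

⋂-isComplex : ∀ {Gs : List (Hypergraph n)} → All IsComplex Gs → IsComplex (⋂ Gs)
⋂-isComplex {Gs = Gs} complexes =
    (λ e t → proj₂ (to (E-⋂ Gs e) t))
  , (λ e e′ e′⊆e t → let e∈Gs , e⊆ = to (E-⋂ Gs e) t in
       from (E-⋂ Gs e′)
         ( All.zipWith (λ ((_ , closed) , e∈A) → closed e e′ e′⊆e e∈A) (complexes , e∈Gs)
         , ⊆-trans e′⊆e e⊆))

-- Edge sets are boolean predicates, so hypergraphs are compared extensionally.
_≗ᴴ_ : Hypergraph n → Hypergraph n → Set
A ≗ᴴ B = V A ≡ V B × E A ≗ E B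

countˢ-cong : ∀ {P Q : Subset n → Bool} → P ≗ Q → countˢ P ≡ countˢ Q
countˢ-cong {n} {P} {Q} P≗Q = cong length
  (filter-≐ (T? ∘ P) (T? ∘ Q) ((λ {s} → subst T (P≗Q s)) , (λ {s} → subst T (sym (P≗Q s))))
             (allSubsets n))

allˢ-cong : ∀ {P Q : Subset n → Bool} → P ≗ Q → allˢ P ≡ allˢ Q
allˢ-cong {n} P≗Q = foldr-cong (λ s b → cong (_∧ b) (P≗Q s)) refl (allSubsets n)

module ≗ᴴ-Invariance (S : Scalars) {W : Subset n} {E₁ E₂ : Subset n → Bool} (E₁≗E₂ : E₁ ≗ E₂) where
  open Scalars S using (fromℕ) renaming (_≤_ to _≤ₛ_; _*_ to _*ₛ_)

  private
    A B : Hypergraph n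
    A = hg W E₁
    B = hg W E₂

  linkCount-cong : ∀ q r e → linkCount A q r e ≡ linkCount B q r e
  linkCount-cong q r e = countˢ-cong λ f →
    cong (λ b → (f ⊆ᵇ (W ─ e)) ∧ (∣ f ∣ ≡ᵇ (q ∸ r)) ∧ b) (E₁≗E₂ (e ∪ f))

  extCount-cong : ∀ q r e → extCount A q r e ≡ extCount B q r e
  extCount-cong q r e = countˢ-cong λ Q →
    cong (λ b → (Q ⊆ᵇ (W ─ e)) ∧ (∣ Q ∣ ≡ᵇ (q ∸ r)) ∧ b) (allˢ-cong λ s →
      cong (not ((s ⊆ᵇ (Q ∪ e)) ∧ (∣ s ∣ ≡ᵇ r) ∧ not (s ==ˢ e)) ∨_) (E₁≗E₂ s))

  InLayer-resp : ∀ {r e} → InLayer B r e → InLayer A r e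
  InLayer-resp {e = e} (e∈B , ∣e∣≡r) = subst T (sym (E₁≗E₂ e)) e∈B , ∣e∣≡r

  Regular-resp : ∀ {ε d q r} → Regular S ε d q r A → Regular S ε d q r B
  Regular-resp {q = q} {r} regular e e∈Bᵣ rewrite sym (linkCount-cong q r e) =
    regular e (InLayer-resp e∈Bᵣ)

  Dense-resp : ∀ {ξ q r} → Dense S ξ q r A → Dense S ξ q r B
  Dense-resp {q = q} {r} dense e e∈Bᵣ rewrite sym (linkCount-cong q r e) =
    dense e (InLayer-resp e∈Bᵣ)

  Extendable-resp : ∀ {ξ q r} → Extendable S ξ q r A → Extendable S ξ q r B
  Extendable-resp (inj₁ noEdges) = inj₁ λ e e∈B → noEdges e (subst T (sym (E₁≗E₂ e)) e∈B)
  Extendable-resp {ξ} {q} {r} (inj₂ (X , X⊆W , large , extends)) =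
    inj₂ (X , X⊆W , large , λ e e⊆X ∣e∣≡r →
      subst (λ m → ξ *ₛ fromℕ (∣ W ∣ ^ (q ∸ r)) ≤ₛ fromℕ m) (extCount-cong q r e)
            (extends e e⊆X ∣e∣≡r))

  FullComplex-resp : ∀ {ε ξ q r} → FullComplex S ε ξ q r A → FullComplex S ε ξ q r B
  FullComplex-resp ((d , ξ≤d , regular) , dense , extendable) =
    (d , ξ≤d , Regular-resp regular) , Dense-resp dense , Extendable-resp extendable

QRComplex-resp : ∀ (S : Scalars) {ε ξ q r} {A B : Hypergraph n} →
  A ≗ᴴ B → QRComplex S ε ξ q r A → QRComplex S ε ξ q r B
QRComplex-resp S {q = q} {A = hg W E₁} {hg .W E₂} (refl , E₁≗E₂) (Y , Y-graph , full) =
  Y , Y-graph , ≗ᴴ-Invariance.FullComplex-resp S restrict-cong full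
  where
  restrict-cong : E (restrict q (hg W E₁) Y) ≗ E (restrict q (hg W E₂) Y)
  restrict-cong e = cong (_∧ allˢ (λ y → not ((y ⊆ᵇ e) ∧ (∣ y ∣ ≡ᵇ q)) ∨ Y y)) (E₁≗E₂ e)

T-injective : ∀ {a b} → T a ⇔ T b → a ≡ b
T-injective a⇔b = ⇔→≡ (⇔.trans (⇔.sym T-≡) (⇔.trans a⇔b T-≡))

≗ᴴ-from-⇔ : ∀ {A B : Hypergraph n} → (∀ {x} → x ∈ V A ⇔ x ∈ V B) →
  (∀ e → T (E A e) ⇔ T (E B e)) → A ≗ᴴ B
≗ᴴ-from-⇔ V⇔ E⇔ = ⊆-antisym (to V⇔) (from V⇔) , λ e → T-injective (E⇔ e)

_⊗_ : List (Subset n) → List (Subset n) → List (Subset n)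
F ⊗ F′ = cartesianProductWith _∪_ F F′

-- The side condition f′ ∪ e ⊆ W ─ f on an edge e of G(f)(f′) is implied: G(f)(f′) = G(f ∪ f′).
∪-⊆─-redundant : ∀ {W f f′ e : Subset n} {P : Subset n → Set} → f′ ⊆ W ─ f →
  (e ⊆ W ─ (f ∪ f′) × (f′ ∪ e ⊆ W ─ f × P (f ∪ (f′ ∪ e)))) ⇔ (e ⊆ W ─ (f ∪ f′) × P ((f ∪ f′) ∪ e))
∪-⊆─-redundant {W = W} {f} {f′} {e} {P} f′⊆W─f = mk⇔
  (λ (e⊆ , _ , p) → e⊆ , subst P (sym (∪-assoc f f′ e)) p)
  (λ (e⊆ , p) → e⊆ , f′∪e⊆W─f e⊆ , subst P (∪-assoc f f′ e) p)
  where
  f′∪e⊆W─f : e ⊆ W ─ (f ∪ f′) → f′ ∪ e ⊆ W ─ f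
  f′∪e⊆W─f e⊆ x∈ = [ f′⊆W─f , (λ x∈e → proj₁ (to ∈─∪⇔ (e⊆ x∈e))) ] (x∈p∪q⁻ f′ e x∈)

-- F must be nonempty: ⋂ [] has vertex set ⊤, not a subset of V G.
module LinkOfLinkIntersection (G : Hypergraph n) (F : List (Subset n)) (F≢[] : 1 ≤ length F) where
  open import Relation.Binary.Reasoning.Setoid (⇔.⇔-setoid 0ℓ)

  H : Hypergraph n
  H = ⋂ (map (link G) F)

  ∈-V─ : ∀ {f′ x} → x ∈ V H ─ f′ ⇔ All (λ f → x ∈ V G ─ (f ∪ f′)) F
  ∈-V─ {f′} {x} = begin
    x ∈ V H ─ f′                                 ≈⟨ ∈─⇔ ⟩
    (x ∈ V H × x ∉ f′)                           ≈⟨ ∈-V-⋂link G F ×-⇔ ⇔.refl ⟩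
    (All (λ f → x ∈ V G ─ f) F × x ∉ f′)         ≈⟨ ⇔.sym (All-×-constʳ F≢[]) ⟩
    All (λ f → x ∈ V G ─ f × x ∉ f′) F           ≈⟨ All-cong (⇔.sym ∈─∪⇔) ⟩
    All (λ f → x ∈ V G ─ (f ∪ f′)) F             ∎

  ⊆-V─ : ∀ {f′ e} → e ⊆ V H ─ f′ ⇔ All (λ f → e ⊆ V G ─ (f ∪ f′)) F
  ⊆-V─ {f′} = ⇔.trans (mk⇔ (λ e⊆ {x} x∈e → to (∈-V─ {f′}) (e⊆ x∈e))
                            (λ e⊆ {x} x∈e → from (∈-V─ {f′}) (e⊆ x∈e))) ⊆-All⇔

  ∈-V-⋂link-⊗ : ∀ F′ {x} → x ∈ V (⋂ (map (link H) F′)) ⇔ x ∈ V (⋂ (map (link G) (F ⊗ F′)))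
  ∈-V-⋂link-⊗ F′ {x} = begin
    x ∈ V (⋂ (map (link H) F′))                       ≈⟨ ∈-V-⋂link H F′ ⟩
    All (λ f′ → x ∈ V H ─ f′) F′                       ≈⟨ All-cong ∈-V─ ⟩
    All (λ f′ → All (λ f → x ∈ V G ─ (f ∪ f′)) F) F′  ≈⟨ ⇔.sym (All-cartesianProductWith⇔ _∪_ F F′) ⟩
    All (λ g → x ∈ V G ─ g) (F ⊗ F′)                   ≈⟨ ⇔.sym (∈-V-⋂link G (F ⊗ F′)) ⟩
    x ∈ V (⋂ (map (link G) (F ⊗ F′)))                 ∎

  E-link-⊗ : ∀ {f′ e} → T (E H f′) →
    (e ⊆ V H ─ f′ × T (E H (f′ ∪ e))) ⇔ All (λ f → e ⊆ V G ─ (f ∪ f′) × T (E G ((f ∪ f′) ∪ e))) F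
  E-link-⊗ {f′} {e} f′∈H = begin
    (e ⊆ V H ─ f′ × T (E H (f′ ∪ e)))
      ≈⟨ ⊆-V─ ×-⇔ E-⋂link G F (f′ ∪ e) ⟩
    (All (λ f → e ⊆ V G ─ (f ∪ f′)) F × All (λ f → f′ ∪ e ⊆ V G ─ f × T (E G (f ∪ (f′ ∪ e)))) F)
      ≈⟨ mk⇔ All.zip All.unzip ⟩
    All (λ f → e ⊆ V G ─ (f ∪ f′) × (f′ ∪ e ⊆ V G ─ f × T (E G (f ∪ (f′ ∪ e))))) F
      ≈⟨ All-cong-on (All.map proj₁ (to (E-⋂link G F f′) f′∈H)) (∪-⊆─-redundant {P = T ∘ E G}) ⟩
    All (λ f → e ⊆ V G ─ (f ∪ f′) × T (E G ((f ∪ f′) ∪ e))) F ∎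

  E-⋂link-⊗ : ∀ {F′} → All (λ f′ → T (E H f′)) F′ → ∀ e →
    T (E (⋂ (map (link H) F′)) e) ⇔ T (E (⋂ (map (link G) (F ⊗ F′))) e)
  E-⋂link-⊗ {F′} F′⊆H e = begin
    T (E (⋂ (map (link H) F′)) e)
      ≈⟨ E-⋂link H F′ e ⟩
    All (λ f′ → e ⊆ V H ─ f′ × T (E H (f′ ∪ e))) F′
      ≈⟨ All-cong-on F′⊆H E-link-⊗ ⟩
    All (λ f′ → All (λ f → e ⊆ V G ─ (f ∪ f′) × T (E G ((f ∪ f′) ∪ e))) F) F′
      ≈⟨ ⇔.sym (All-cartesianProductWith⇔ _∪_ F F′) ⟩
    All (λ g → e ⊆ V G ─ g × T (E G (g ∪ e))) (F ⊗ F′)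
      ≈⟨ ⇔.sym (E-⋂link G (F ⊗ F′) e) ⟩
    T (E (⋂ (map (link G) (F ⊗ F′))) e) ∎

  ⋂link-⊗≗ᴴ : ∀ {F′} → All (λ f′ → T (E H f′)) F′ →
    ⋂ (map (link G) (F ⊗ F′)) ≗ᴴ ⋂ (map (link H) F′)
  ⋂link-⊗≗ᴴ {F′} F′⊆H = ≗ᴴ-from-⇔ (⇔.sym (∈-V-⋂link-⊗ F′)) (λ e → ⇔.sym (E-⋂link-⊗ F′⊆H e))

  ⊗-disjoint : ∀ {F′} → All (λ f′ → T (E H f′)) F′ →
    ∀ {f f′} → f ∈ₗ F → f′ ∈ₗ F′ → Disjoint f f′
  ⊗-disjoint F′⊆H f∈F f′∈F′ x∈f x∈f′ =
    x∈p─q⇒x∉q (V G) _ (proj₁ (All.lookup (to (E-⋂link G F _) (All.lookup F′⊆H f′∈F′)) f∈F) x∈f′) x∈f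

Admissible : Hypergraph n → ℕ → List (Subset n) → Set
Admissible G i F = Unique F × All (InLayer G i) F × 1 ≤ length F × length F ≤ 2 ^ i

⊗-admissible : ∀ {G : Hypergraph n} {i i′ F F′} → Admissible G i F →
  Admissible (⋂ (map (link G) F)) i′ F′ →
  Admissible G (i + i′) (F ⊗ F′)
⊗-admissible {G = G} {i} {i′} {F} {F′}
             (F! , F⊆Gᵢ , 1≤|F| , |F|≤2ⁱ) (F′! , F′⊆Hᵢ′ , 1≤|F′| , |F′|≤2ⁱ′) =
    Unique-cartesianProductWith⁺ _∪_
      (λ w∈ x∈ y∈ z∈ → ∪-cancel (disjoint w∈ z∈) (disjoint x∈ y∈)) F! F′!
  , from (All-cartesianProductWith⇔ _∪_ F F′) (All.tabulate λ f′∈F′ → All.tabulate λ f∈F →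
      layer (All.lookup F⊆Gᵢ f∈F) (All.lookup F′⊆Hᵢ′ f′∈F′) f∈F f′∈F′)
  , subst (1 ≤_) (sym |F⊗F′|) (*-mono-≤ 1≤|F| 1≤|F′|)
  , subst₂ _≤_ (sym |F⊗F′|) (sym (^-distribˡ-+-* 2 i i′)) (*-mono-≤ |F|≤2ⁱ |F′|≤2ⁱ′)
  where
  open LinkOfLinkIntersection G F 1≤|F|
  disjoint : ∀ {f f′} → f ∈ₗ F → f′ ∈ₗ F′ → Disjoint f f′
  disjoint = ⊗-disjoint (All.map proj₁ F′⊆Hᵢ′)
  |F⊗F′| : length (F ⊗ F′) ≡ length F * length F′
  |F⊗F′| = length-cartesianProductWith _∪_ F F′
  layer : ∀ {f f′} → InLayer G i f → InLayer H i′ f′ → f ∈ₗ F → f′ ∈ₗ F′ →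
          InLayer G (i + i′) (f ∪ f′)
  layer (_ , ∣f∣≡i) (f′∈H , ∣f′∣≡i′) f∈F f′∈F′ =
      proj₂ (All.lookup (to (E-⋂link G F _) f′∈H) f∈F)
    , trans (∣p∪q∣≡∣p∣+∣q∣ _ _ (disjoint f∈F f′∈F′)) (cong₂ _+_ ∣f∣≡i ∣f′∣≡i′)

Supercomplex⇒QRComplex : ∀ (S : Scalars) {ε ξ q r i F} {G : Hypergraph n} →
  Supercomplex S ε ξ q r G → i ≤ r → Admissible G i F →
  QRComplex S ε ξ (q ∸ i) (r ∸ i) (⋂ (map (link G) F))
Supercomplex⇒QRComplex S G-super i≤r (F! , F⊆Gᵢ , 1≤|F| , |F|≤2ⁱ) =
  G-super _ i≤r _ F! F⊆Gᵢ 1≤|F| |F|≤2ⁱ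

proposition5p1 : (S : Scalars) → (N q r : ℕ) → r < q →
    (ε ξ : Scalars.Carrier S) →
    Scalars._≤_ S (Scalars.0# S) ε → Scalars._≤_ S ε (Scalars.1# S) →
    Scalars._≤_ S (Scalars.0# S) ξ → Scalars._≤_ S ξ (Scalars.1# S) →
    (G : Hypergraph N) → IsComplex G → Supercomplex S ε ξ q r G →
    (i : ℕ) → i ≤ r → (F : List (Subset N)) → Unique F → All (InLayer G i) F →
    1 ≤ length F → length F ≤ 2 ^ i →
    IsComplex (⋂ (map (link G) F))
      × Supercomplex S ε ξ (q ∸ i) (r ∸ i) (⋂ (map (link G) F))
proposition5p1 S N q r _ ε ξ _ _ _ _ G G-complex G-super i i≤r F F! F⊆Gᵢ 1≤|F| |F|≤2ⁱ =
  ⋂-isComplex (All.map⁺ (All.universal (link-isComplex G-complex) F)) , H-super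
  where
  open LinkOfLinkIntersection G F 1≤|F|
  H-super : Supercomplex S ε ξ (q ∸ i) (r ∸ i) H
  H-super i′ i′≤r∸i F′ F′! F′⊆Hᵢ′ 1≤|F′| |F′|≤2ⁱ′ =
    subst₂ (λ q′ r′ → QRComplex S ε ξ q′ r′ (⋂ (map (link H) F′)))
      (sym (∸-+-assoc q i i′)) (sym (∸-+-assoc r i i′))
      (QRComplex-resp S (⋂link-⊗≗ᴴ (All.map proj₁ F′⊆Hᵢ′))
        (Supercomplex⇒QRComplex S G-super i+i′≤r
          (⊗-admissible (F! , F⊆Gᵢ , 1≤|F| , |F|≤2ⁱ) (F′! , F′⊆Hᵢ′ , 1≤|F′| , |F′|≤2ⁱ′))))
    where
    i+i′≤r : i + i′ ≤ r
    i+i′≤r = ≤-trans (+-monoʳ-≤ i i′≤r∸i) (≤-reflexive (m+[n∸m]≡n i≤r))
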